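{- Let $G$ be a simple undirected graph on $n$ vertices with maximum degree at most $d$, let $S$ be a set of vertices of $G$, let $0<\alpha<1$, let $\ell\ge1$, and let $s\in S$ be a special vertex for $S$ (i.e. $q_v>\alpha$ for all $v\in S$). For an edge $(u,v)$ of $G_S$, the directed edges $\langle u,v\rangle$ and $\langle v,u\rangle$ cannot both be dominant.
   Context: Random walks: all random walks start at $s$, have length $\ell$, and are lazy walks in $G$ in which each edge incident to the current vertex is taken with probability exactly $1/(2d)$ and the walk stays put with the remaining probability. A walk reaches $v$ if it visits $v$; $q_v$ is the probability that a walk reaches $v$. The path induced by a walk reaching $v$ is the path from $s$ to (the first visit of) $v$ obtained from the walk up to that visit by removing self-loop steps and retraced (backtracked) portions. $G_S$ is the subgraph of $G$ induced by $S$. A vertex $v\in S$ is isolated if more than half of the walks that reach $v$ induce the same path (the dominant path to $v$), and the probability that a walk reaches $v$ and induces a different path is $<\alpha/2$. A directed edge $\langle u,v\rangle$ (with $(u,v)$ an edge of $G_S$) is dominant if (1) $v$ is isolated and (2) the probability that a walk reaches $v$ without passing through the edge $(u,v)$ is $<\alpha/2$. -}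

module Defs where

open import Data.Nat using (ℕ; zero; suc; NonZero) renaming (_*_ to _*ℕ_; _≤_ to _≤ℕ_)
open import Data.Nat.Properties using (m*n≢0)
open import Data.Integer using (+_)
open import Data.Rational using (ℚ; 0ℚ; 1ℚ; ½; _+_; _*_; _-_; _/_; _<_)
open import Data.Fin using (Fin; _≟_)
open import Data.Fin.Subset using (Subset; _∈_)
open import Data.Bool using (Bool; true; false; if_then_else_; _∧_; _∨_; not; T)
open import Data.List using (List; []; _∷_; map; concatMap; foldr; reverse; length; filter)
open import Data.List.Base using (allFin)
open import Data.List.Properties using (≡-dec)
open import Data.Maybe using (Maybe; just; nothing; is-just)
open import Data.Product using (Σ; _×_; _,_)
open import Relation.Nullary.Decidable using (⌊_⌋)
open import Relation.Binary.PropositionalEquality using (_≡_)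

record SimpleGraph (n : ℕ) : Set where
  field
    E     : Fin n → Fin n → Bool
    sym   : ∀ u v → E u v ≡ E v u
    loopless : ∀ v → E v v ≡ false

open SimpleGraph public

deg : ∀ {n} → SimpleGraph n → Fin n → ℕ
deg G v = length (filter (λ w → T? (E G v w)) (allFin _))
  where
  open import Data.Bool.Properties using () renaming (T? to T?)

MaxDegree≤ : ∀ {n} → SimpleGraph n → ℕ → Set
MaxDegree≤ G d = ∀ v → deg G v ≤ℕ d

EdgeIn : ∀ {n} → SimpleGraph n → Subset n → Fin n → Fin n → Set
EdgeIn G S u v = T (E G u v) × u ∈ S × v ∈ S

-- Lazy random walks of length ℓ from s, with parameter d.
-- A walk is represented by its list of positions x₀ = s, x₁, …, x_ℓ.

module Walks {n : ℕ} (G : SimpleGraph n) (d : ℕ) .{{_ : NonZero d}}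
             (ℓ : ℕ) (s : Fin n) where

  private
    instance
      2d≢0 : NonZero (2 *ℕ d)
      2d≢0 = m*n≢0 2 d

    _==_ : Fin n → Fin n → Bool
    x == y = ⌊ x ≟ y ⌋

  step : Fin n → Fin n → ℚ
  step x y = if x == y then 1ℚ - (+ deg G x / (2 *ℕ d))
             else (if E G x y then + 1 / (2 *ℕ d) else 0ℚ)

  -- all position sequences with k further steps starting at x
  -- (sequences with invalid steps get weight 0 below)
  seqs : ℕ → Fin n → List (List (Fin n))
  seqs zero    x = (x ∷ []) ∷ []
  seqs (suc k) x = concatMap (λ y → map (x ∷_) (seqs k y)) (allFin n)

  weight : List (Fin n) → ℚ
  weight []               = 1ℚ
  weight (x ∷ [])         = 1ℚ
  weight (x ∷ y ∷ rest)   = step x y * weight (y ∷ rest)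

  Event : Set
  Event = List (Fin n) → Bool

  Pr : Event → ℚ
  Pr A = foldr (λ w acc → (if A w then weight w else 0ℚ) + acc) 0ℚ (seqs ℓ s)

  upToFirst : Fin n → List (Fin n) → Maybe (List (Fin n))
  upToFirst v []       = nothing
  upToFirst v (x ∷ xs) = if x == v then just (x ∷ [])
                         else Data.Maybe.map (x ∷_) (upToFirst v xs)

  reaches : Fin n → Event
  reaches v w = is-just (upToFirst v w)

  q : Fin n → ℚ
  q v = Pr (reaches v)

  -- remove self-loop steps and backtracked portions (free reduction),
  -- using a stack holding the reduced prefix in reverse order
  reduceAcc : List (Fin n) → List (Fin n) → List (Fin n)
  reduceAcc st []                   = reverse st
  reduceAcc [] (x ∷ xs)             = reduceAcc (x ∷ []) xs
  reduceAcc (a ∷ []) (x ∷ xs)       =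
    if x == a then reduceAcc (a ∷ []) xs else reduceAcc (x ∷ a ∷ []) xs
  reduceAcc (a ∷ b ∷ st) (x ∷ xs)   =
    if x == a then reduceAcc (a ∷ b ∷ st) xs
    else (if x == b then reduceAcc (b ∷ st) xs
          else reduceAcc (x ∷ a ∷ b ∷ st) xs)

  reduce : List (Fin n) → List (Fin n)
  reduce = reduceAcc []

  inducedPath : Fin n → List (Fin n) → Maybe (List (Fin n))
  inducedPath v w = Data.Maybe.map reduce (upToFirst v w)

  inducesPath : Fin n → List (Fin n) → Event
  inducesPath v p w with inducedPath v w
  ... | nothing = false
  ... | just p′ = ⌊ ≡-dec _≟_ p′ p ⌋

  inducesOtherPath : Fin n → List (Fin n) → Event
  inducesOtherPath v p w with inducedPath v w
  ... | nothing = false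
  ... | just p′ = not ⌊ ≡-dec _≟_ p′ p ⌋

  traverses : Fin n → Fin n → List (Fin n) → Bool
  traverses u v []             = false
  traverses u v (x ∷ [])       = false
  traverses u v (x ∷ y ∷ rest) =
    ((x == u ∧ y == v) ∨ (x == v ∧ y == u)) ∨ traverses u v (y ∷ rest)

  reachesAvoiding : Fin n → Fin n → Event
  reachesAvoiding u v w with upToFirst v w
  ... | nothing = false
  ... | just pre = not (traverses u v pre)

  Special : Subset n → ℚ → Set
  Special S α = s ∈ S × (∀ v → v ∈ S → α < q v)

  Isolated : Subset n → ℚ → Fin n → Set
  Isolated S α v =
    v ∈ S ×
    Σ (List (Fin n)) λ p →
      (½ * q v < Pr (inducesPath v p)) ×
      (Pr (inducesOtherPath v p) < ½ * α)

  Dominant : Subset n → ℚ → Fin n → Fin n → Set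
  Dominant S α u v =
    EdgeIn G S u v ×
    Isolated S α v ×
    (Pr (reachesAvoiding u v) < ½ * α)

module Submission where

open import Defs hiding (sym)
open import Data.Nat using (ℕ; NonZero; _≥_)
open import Data.Rational using (ℚ; 0ℚ; 1ℚ; _<_)
open import Data.Fin using (Fin; _≟_)
open import Data.Fin.Subset using (Subset; _∈_)
open import Data.Product using (_×_; _,_)
open import Relation.Nullary using (¬_; yes; no; contradiction)

import Data.Nat as ℕ
import Data.Nat.Properties as ℕ
open import Data.Integer using (+_; +≤+) renaming (_≤_ to _≤ℤ_)
import Data.Integer.Properties as ℤ
import Data.Rational.Unnormalised as ℚᵘ
import Data.Rational.Unnormalised.Properties as ℚᵘ
open import Data.Rational using (nonNegative; ½; _≤_; _+_; _*_; _-_; -_; _/_)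
open import Data.Rational.Properties hiding (_≟_)
open import Algebra.Bundles using (CommutativeMonoid)
open import Algebra.Properties.CommutativeSemigroup
  (CommutativeMonoid.commutativeSemigroup +-0-commutativeMonoid) using (interchange)
open import Data.Bool using (Bool; true; false; if_then_else_; not; T; _∨_)
open import Data.Bool.Properties using (∨-zeroʳ)
open import Data.List using (List; []; _∷_; foldr)
open import Data.Maybe using (Maybe; just; nothing; is-just)
import Data.Maybe as Maybe
open import Data.Unit using (tt)
open import Relation.Nullary.Decidable using (⌊_⌋)
open import Relation.Binary.PropositionalEquality
  using (_≡_; refl; sym; trans; cong; subst; subst₂)

-- A walk reaching v either reaches v before u, or reaches u first. In the first case the
-- walk up to its first visit of v never visited u, so it avoids the edge (u,v); in the
-- second case the walk up to its first visit of u never visited v and avoids (v,u).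
-- Hence q_v ≤ Pr[reach v avoiding (u,v)] + Pr[reach u avoiding (v,u)], and if both
-- directed edges were dominant the right-hand side would be below α/2 + α/2 = α < q_v.

k/m≤1 : ∀ {k m} .{{_ : NonZero m}} → k ℕ.≤ m → + k / m ≤ 1ℚ
k/m≤1 {k} {ℕ.suc m} k≤m =
  toℚᵘ-cancel-≤ (ℚᵘ.≤-respˡ-≃ (ℚᵘ.≃-sym (toℚᵘ-fromℚᵘ (ℚᵘ.mkℚᵘ (+ k) m)))
    (ℚᵘ.*≤* (subst₂ _≤ℤ_ (sym (ℤ.*-identityʳ (+ k))) (sym (ℤ.*-identityˡ (+ ℕ.suc m)))
      (+≤+ k≤m))))

p≤q⇒0≤q-p : ∀ {p q} → p ≤ q → 0ℚ ≤ q - p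
p≤q⇒0≤q-p {p} {q} p≤q = subst (_≤ q - p) (+-inverseʳ p) (+-monoˡ-≤ (- p) p≤q)

0≤p*q : ∀ {p q} → 0ℚ ≤ p → 0ℚ ≤ q → 0ℚ ≤ p * q
0≤p*q {p} {q} 0≤p 0≤q = nonNegative⁻¹ (p * q)
  {{nonNeg*nonNeg⇒nonNeg p {{nonNegative 0≤p}} q {{nonNegative 0≤q}}}}

½p+½p≡p : ∀ p → ½ * p + ½ * p ≡ p
½p+½p≡p p = trans (sym (*-distribʳ-+ p ½ ½)) (*-identityˡ p)

module _ {A : Set} (μ : A → ℚ) (μ-nonNeg : ∀ x → 0ℚ ≤ μ x) where

  mass : (A → Bool) → List A → ℚ
  mass P = foldr (λ x acc → (if P x then μ x else 0ℚ) + acc) 0ℚ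

  private
    μ-if : Bool → A → ℚ
    μ-if b x = if b then μ x else 0ℚ

    μ-if-nonNeg : ∀ b x → 0ℚ ≤ μ-if b x
    μ-if-nonNeg true  x = μ-nonNeg x
    μ-if-nonNeg false x = ≤-refl

    μ-if-subadditive : ∀ x (b c e : Bool) → (T b → T (c ∨ e)) → μ-if b x ≤ μ-if c x + μ-if e x
    μ-if-subadditive x false c     e    _  = +-mono-≤ (μ-if-nonNeg c x) (μ-if-nonNeg e x)
    μ-if-subadditive x true  true  e    _  =
      subst (_≤ μ x + μ-if e x) (+-identityʳ (μ x)) (+-monoʳ-≤ (μ x) (μ-if-nonNeg e x))
    μ-if-subadditive x true  false true _  = ≤-reflexive (sym (+-identityˡ (μ x)))
    μ-if-subadditive x true  false false b⇒ = contradiction (b⇒ tt) λ ()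

  mass-subadditive : ∀ {P Q R} → (∀ x → T (P x) → T (Q x ∨ R x)) →
                     ∀ xs → mass P xs ≤ mass Q xs + mass R xs
  mass-subadditive P⊆Q∪R []       = ≤-refl
  mass-subadditive {P} {Q} {R} P⊆Q∪R (x ∷ xs) =
    subst (mass P (x ∷ xs) ≤_)
      (interchange (μ-if (Q x) x) (μ-if (R x) x) (mass Q xs) (mass R xs))
      (+-mono-≤ (μ-if-subadditive x (P x) (Q x) (R x) (P⊆Q∪R x))
                (mass-subadditive {P} {Q} {R} P⊆Q∪R xs))

module _ {n : ℕ} (G : SimpleGraph n) (d : ℕ) .{{_ : NonZero d}} (ℓ : ℕ) (s : Fin n) where
  open Walks G d ℓ s

  private
    instance
      2d≢0 : NonZero (2 ℕ.* d)
      2d≢0 = ℕ.m*n≢0 2 d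

    if-lower-bound : ∀ b {r p q} → r ≤ p → r ≤ q → r ≤ (if b then p else q)
    if-lower-bound true  r≤p _   = r≤p
    if-lower-bound false _   r≤q = r≤q

  step-nonNeg : MaxDegree≤ G d → ∀ x y → 0ℚ ≤ step x y
  step-nonNeg maxDeg x y =
    if-lower-bound ⌊ x ≟ y ⌋ (p≤q⇒0≤q-p (k/m≤1 (ℕ.≤-trans (maxDeg x) (ℕ.m≤n*m d 2))))
      (if-lower-bound (E G x y) 1/2d-nonNeg ≤-refl)
    where
    1/2d-nonNeg : 0ℚ ≤ + 1 / (2 ℕ.* d)
    1/2d-nonNeg = nonNegative⁻¹ _ {{normalize-nonNeg 1 (2 ℕ.* d)}}

  weight-nonNeg : MaxDegree≤ G d → ∀ w → 0ℚ ≤ weight w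
  weight-nonNeg maxDeg []          = nonNegative⁻¹ 1ℚ
  weight-nonNeg maxDeg (x ∷ [])    = nonNegative⁻¹ 1ℚ
  weight-nonNeg maxDeg (x ∷ y ∷ w) = 0≤p*q (step-nonNeg maxDeg x y) (weight-nonNeg maxDeg (y ∷ w))

  Pr-subadditive : MaxDegree≤ G d → ∀ {A B C : Event} → (∀ w → T (A w) → T (B w ∨ C w)) →
                   Pr A ≤ Pr B + Pr C
  Pr-subadditive maxDeg {A} {B} {C} A⊆B∪C =
    mass-subadditive weight (weight-nonNeg maxDeg) {A} {B} {C} A⊆B∪C (seqs ℓ s)

  private
    avoids : Fin n → Fin n → Maybe (List (Fin n)) → Bool
    avoids a b nothing    = false
    avoids a b (just pre) = not (traverses a b pre)

    reachesAvoiding≡avoids : ∀ a b w → reachesAvoiding a b w ≡ avoids a b (upToFirst b w)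
    reachesAvoiding≡avoids a b w with upToFirst b w
    ... | nothing = refl
    ... | just _  = refl

    traverses-∷ : ∀ {a b x} → ¬ x ≡ a → ¬ x ≡ b → ∀ p → traverses a b (x ∷ p) ≡ traverses a b p
    traverses-∷ x≢a x≢b []      = refl
    traverses-∷ {a} {b} {x} x≢a x≢b (y ∷ p) with x ≟ a | x ≟ b
    ... | yes x≡a | _       = contradiction x≡a x≢a
    ... | no _    | yes x≡b = contradiction x≡b x≢b
    ... | no _    | no _    = refl

    avoids-∷ : ∀ {a b x} → ¬ x ≡ a → ¬ x ≡ b → ∀ m → avoids a b (Maybe.map (x ∷_) m) ≡ avoids a b m
    avoids-∷ x≢a x≢b nothing  = refl
    avoids-∷ x≢a x≢b (just p) = cong not (traverses-∷ x≢a x≢b p)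

    is-just-map : ∀ {X Y : Set} (f : X → Y) m → is-just (Maybe.map f m) ≡ is-just m
    is-just-map f nothing  = refl
    is-just-map f (just _) = refl

    firstVisit-avoids : ∀ u v w → T (reaches v w) →
                        T (avoids u v (upToFirst v w) ∨ avoids v u (upToFirst u w))
    firstVisit-avoids u v (x ∷ xs) r with x ≟ v | x ≟ u
    ... | yes _  | _      = tt
    ... | no _   | yes _  = subst T (sym (∨-zeroʳ _)) tt
    ... | no x≢v | no x≢u
      rewrite avoids-∷ x≢u x≢v (upToFirst v xs) | avoids-∷ x≢v x≢u (upToFirst u xs)
            | is-just-map (x ∷_) (upToFirst v xs)
      = firstVisit-avoids u v xs r

  reaches⇒reachesAvoiding-either : ∀ u v w → T (reaches v w) →
                                   T (reachesAvoiding u v w ∨ reachesAvoiding v u w)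
  reaches⇒reachesAvoiding-either u v w r
    rewrite reachesAvoiding≡avoids u v w | reachesAvoiding≡avoids v u w = firstVisit-avoids u v w r

  q≤Pr[reachesAvoiding]+Pr[reachesAvoiding] : MaxDegree≤ G d → ∀ u v →
    q v ≤ Pr (reachesAvoiding u v) + Pr (reachesAvoiding v u)
  q≤Pr[reachesAvoiding]+Pr[reachesAvoiding] maxDeg u v =
    Pr-subadditive maxDeg {reaches v} {reachesAvoiding u v} {reachesAvoiding v u}
      (reaches⇒reachesAvoiding-either u v)

claim2 : ∀ {n : ℕ} (G : SimpleGraph n) (d : ℕ) .{{_ : NonZero d}}
         → MaxDegree≤ G d
         → (S : Subset n) (α : ℚ) → 0ℚ < α → α < 1ℚ
         → (ℓ : ℕ) → ℓ ≥ 1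
         → (s : Fin n) → Walks.Special G d ℓ s S α
         → (u v : Fin n) → EdgeIn G S u v
         → ¬ (Walks.Dominant G d ℓ s S α u v × Walks.Dominant G d ℓ s S α v u)
claim2 G d maxDeg S α _ _ ℓ _ s (_ , α<q) u v (_ , _ , v∈S)
       ((_ , _ , avoid-uv<α/2) , (_ , _ , avoid-vu<α/2)) =
  <-irrefl refl (begin-strict
    α                                                   <⟨ α<q v v∈S ⟩
    q v                                                 ≤⟨ q-bound ⟩
    Pr (reachesAvoiding u v) + Pr (reachesAvoiding v u) <⟨ +-mono-< avoid-uv<α/2 avoid-vu<α/2 ⟩
    ½ * α + ½ * α                                       ≡⟨ ½p+½p≡p α ⟩
    α                                                   ∎)
  where
  open ≤-Reasoning
  open Walks G d ℓ s
  q-bound : q v ≤ Pr (reachesAvoiding u v) + Pr (reachesAvoiding v u)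
  q-bound = q≤Pr[reachesAvoiding]+Pr[reachesAvoiding] G d ℓ s maxDeg u v
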